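{- Let $a,b,c,d,e,f,g,h,i$ be integers such that $a^2,b^2,\dots,i^2$ are nine distinct integers arranged in the $3\times 3$ grid $$\begin{array}{c|c|c} a^2 & b^2 & c^2\\ \hline d^2 & e^2 & f^2\\ \hline g^2 & h^2 & i^2\end{array}$$ such that the entries of each row, each column, and each of the two main diagonals sum to the same total, and suppose $\gcd(a^2,b^2,\dots,i^2)=1$. Then every prime $p$ dividing the central entry $e^2$ satisfies either $p=2$ or $p\equiv 1 \pmod 4$.
   Context: Such a grid is called a magic square of squares; it is called primitive if the greatest common divisor of all nine entries is $1$. The central entry is $e^2$. -}

module Defs where

open import Data.Integer using (ℤ; +_; _+_; _^_)
open import Data.Integer.GCD using (gcd)
open import Data.List using (List; _∷_; [])
open import Data.List.Relation.Unary.Unique.Propositional using (Unique)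
open import Relation.Binary.PropositionalEquality using (_≡_)
open import Data.Product using (_×_)

squaresList : (a b c d e f g h i : ℤ) → List ℤ
squaresList a b c d e f g h i =
  (a ^ 2) ∷ (b ^ 2) ∷ (c ^ 2) ∷ (d ^ 2) ∷ (e ^ 2) ∷ (f ^ 2) ∷ (g ^ 2) ∷ (h ^ 2) ∷ (i ^ 2) ∷ []

IsMagicSquareOfSquares : (a b c d e f g h i : ℤ) → Set
IsMagicSquareOfSquares a b c d e f g h i =
  Unique (squaresList a b c d e f g h i) ×
  ( (d ^ 2 + e ^ 2 + f ^ 2 ≡ S)
  × (g ^ 2 + h ^ 2 + i ^ 2 ≡ S)
  × (a ^ 2 + d ^ 2 + g ^ 2 ≡ S)
  × (b ^ 2 + e ^ 2 + h ^ 2 ≡ S)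
  × (c ^ 2 + f ^ 2 + i ^ 2 ≡ S)
  × (a ^ 2 + e ^ 2 + i ^ 2 ≡ S)
  × (c ^ 2 + e ^ 2 + g ^ 2 ≡ S))
  where
  S : ℤ
  S = a ^ 2 + b ^ 2 + c ^ 2

gcd9 : (a b c d e f g h i : ℤ) → ℤ
gcd9 a b c d e f g h i =
  gcd (a ^ 2) (gcd (b ^ 2) (gcd (c ^ 2) (gcd (d ^ 2) (gcd (e ^ 2)
    (gcd (f ^ 2) (gcd (g ^ 2) (gcd (h ^ 2) (i ^ 2))))))))

IsPrimitive : (a b c d e f g h i : ℤ) → Set
IsPrimitive a b c d e f g h i = gcd9 a b c d e f g h i ≡ + 1

-- Summing the middle row, the middle column and both diagonals counts every
-- cell once and the centre three more times, so the magic sum is 3e² and any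
-- two cells opposite through the centre satisfy x² + y² = 2e². Let p ≡ 3 (mod 4)
-- be a prime dividing e². Then p divides x² + y² for each opposite pair, and
-- hence divides x and y: otherwise Fermat's little theorem gives
-- x^(p-1) ≡ y^(p-1) ≡ 1 (mod p), while x² + y² divides x^(p-1) + y^(p-1)
-- because (p-1)/2 is odd, so p would divide 2. Thus p divides all nine
-- entries, contradicting primitivity.
module Submission where

module SumsOfTwoSquares where
  open import Data.Nat
  open import Data.Nat.Properties
  open import Data.Nat.Divisibility
  open import Data.Nat.DivMod using (m/n*n≡m)
  open import Data.Nat.Primality
    using (Prime; prime⇒nonTrivial; prime⇒nonZero; prime⇒irreducible; euclidsLemma)
  open import Data.Nat.Combinatorics using (_C_; nCk≡n!/k![n-k]!; k![n∸k]!∣n!; nCn≡1)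
  open import Data.Nat.Tactic.RingSolver using (solve-∀; solve)
  open import Data.List using ([]; _∷_)
  open import Data.Fin using (Fin; zero; suc; toℕ; fromℕ; inject₁)
  open import Data.Fin.Properties using (toℕ-fromℕ; toℕ-inject₁; toℕ<n)
  open import Data.Product using (∃-syntax; _,_)
  open import Data.Sum using (_⊎_; inj₁; inj₂; [_,_]′)
  open import Data.Empty using (⊥-elim)
  open import Function using (id; _∘_)
  open import Relation.Nullary using (¬_; yes; no; contradiction)
  open import Relation.Binary.PropositionalEquality
  open import Algebra.Properties.CommutativeSemiring.Binomial +-*-commutativeSemiring
    using (binomialTerm) renaming (theorem to binomial-theorem)
  open import Algebra.Properties.Semiring.Sum +-*-semiring using (sum; sum-init-last)
  import Algebra.Properties.Semiring.Exp +-*-semiring as Exp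
  import Algebra.Properties.Semiring.Mult +-*-semiring as Mult
  open ≡-Reasoning

  prime⇒p>1 : ∀ {p} → Prime p → p > 1
  prime⇒p>1 {p} pp = nonTrivial⇒n>1 p {{prime⇒nonTrivial pp}}

  prime∣m*m⇒∣m : ∀ {p} → Prime p → ∀ m → p ∣ m * m → p ∣ m
  prime∣m*m⇒∣m pp m = [ id , id ]′ ∘ euclidsLemma m m pp

  n∣n! : ∀ n → .{{NonZero n}} → n ∣ n !
  n∣n! (suc n) = m∣m*n (n !)

  prime∤n! : ∀ {p} → Prime p → ∀ {n} → n < p → ¬ p ∣ n !
  prime∤n! pp {zero}  _   p∣1  = <⇒≱ (prime⇒p>1 pp) (∣⇒≤ p∣1)
  prime∤n! pp {suc n} n<p p∣n! =
    [ <⇒≱ n<p ∘ ∣⇒≤ , prime∤n! pp (<⇒≤ n<p) ]′ (euclidsLemma (suc n) (n !) pp p∣n!)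

  prime∣pCk : ∀ {p k} → Prime p → 0 < k → k < p → p ∣ p C k
  prime∣pCk {p} {k} pp 0<k k<p =
    [ id , ⊥-elim ∘ p∤k![p∸k]! ]′ (euclidsLemma (p C k) (k ! * (p ∸ k) !) pp p∣pCk*k![p∸k]!)
    where
    instance _ = k !* (p ∸ k) !≢0
    pCk*k![p∸k]!≡p! : (p C k) * (k ! * (p ∸ k) !) ≡ p !
    pCk*k![p∸k]!≡p! = trans (cong (_* (k ! * (p ∸ k) !)) (nCk≡n!/k![n-k]! (<⇒≤ k<p)))
                            (m/n*n≡m (k![n∸k]!∣n! (<⇒≤ k<p)))
    p∣pCk*k![p∸k]! : p ∣ (p C k) * (k ! * (p ∸ k) !)
    p∣pCk*k![p∸k]! = subst (p ∣_) (sym pCk*k![p∸k]!≡p!) (n∣n! p {{prime⇒nonZero pp}})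
    p∤k![p∸k]! : ¬ p ∣ k ! * (p ∸ k) !
    p∤k![p∸k]! = [ prime∤n! pp k<p , prime∤n! pp (∸-monoʳ-< 0<k (<⇒≤ k<p)) ]′
               ∘ euclidsLemma (k !) ((p ∸ k) !) pp

  ×≡* : ∀ m n → m Mult.× n ≡ m * n
  ×≡* zero    n = refl
  ×≡* (suc m) n = cong (n +_) (×≡* m n)

  ^≡^ : ∀ m n → m Exp.^ n ≡ m ^ n
  ^≡^ m zero    = refl
  ^≡^ m (suc n) = cong (m *_) (^≡^ m n)

  binomialTerm-1+x : ∀ x n k → binomialTerm 1 x n k ≡ (n C toℕ k) * x ^ (n ∸ toℕ k)
  binomialTerm-1+x x n k = begin
    (n C i) Mult.× (1 Exp.^ i * x Exp.^ (n ∸ i)) ≡⟨ ×≡* (n C i) _ ⟩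
    (n C i) * (1 Exp.^ i * x Exp.^ (n ∸ i))      ≡⟨ cong₂ (λ u v → (n C i) * (u * v)) 1^i≡1 (^≡^ x (n ∸ i)) ⟩
    (n C i) * (1 * x ^ (n ∸ i))                  ≡⟨ cong ((n C i) *_) (*-identityˡ (x ^ (n ∸ i))) ⟩
    (n C i) * x ^ (n ∸ i)                        ∎
    where
    i = toℕ k
    1^i≡1 : 1 Exp.^ i ≡ 1
    1^i≡1 = trans (^≡^ 1 i) (^-zeroˡ i)

  ∣-sum : ∀ {d n} (t : Fin n → ℕ) → (∀ i → d ∣ t i) → d ∣ sum t
  ∣-sum {d} {zero}  t d∣t = d ∣0
  ∣-sum {d} {suc n} t d∣t = ∣m∣n⇒∣m+n (d∣t zero) (∣-sum (t ∘ suc) (d∣t ∘ suc))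

  sum-ends : ∀ {n} (t : Fin (suc (suc n)) → ℕ) →
             sum t ≡ t zero + sum (t ∘ suc ∘ inject₁) + t (fromℕ (suc n))
  sum-ends t = trans (cong (t zero +_) (sum-init-last (t ∘ suc))) (sym (+-assoc (t zero) _ _))

  [1+x]^p≡x^p+1-mod-p : ∀ {p} → Prime p → ∀ x → ∃[ r ] (1 + x) ^ p ≡ x ^ p + r * p + 1
  [1+x]^p≡x^p+1-mod-p {p@(suc (suc m))} pp x with ∣-sum (binomialTerm 1 x p ∘ suc ∘ inject₁) p∣middle
    where
    p∣middle : ∀ j → p ∣ binomialTerm 1 x p (suc (inject₁ j))
    p∣middle j = subst (p ∣_) (sym (binomialTerm-1+x x p (suc (inject₁ j))))
      (∣m⇒∣m*n _ (prime∣pCk pp (s≤s z≤n) (s≤s (subst (_< suc m) (sym (toℕ-inject₁ j)) (toℕ<n j)))))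
  ... | divides r middle≡r*p = r , (begin
    (1 + x) ^ p                         ≡⟨ ^≡^ (1 + x) p ⟨
    (1 + x) Exp.^ p                     ≡⟨ binomial-theorem p 1 x ⟩
    sum term                            ≡⟨ sum-ends term ⟩
    first + sum (term ∘ suc ∘ inject₁) + last
                                        ≡⟨ cong₂ (λ u v → first + u + v) middle≡r*p last≡1 ⟩
    first + r * p + 1                   ≡⟨ cong (λ u → u + r * p + 1) first≡x^p ⟩
    x ^ p + r * p + 1                   ∎)
    where
    term = binomialTerm 1 x p
    first = term zero
    last = term (fromℕ p)
    first≡x^p : first ≡ x ^ p
    first≡x^p = trans (binomialTerm-1+x x p zero) (*-identityˡ (x ^ p))
    last≡1 : last ≡ 1
    last≡1 = begin
      last                                          ≡⟨ binomialTerm-1+x x p (fromℕ p) ⟩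
      (p C toℕ (fromℕ p)) * x ^ (p ∸ toℕ (fromℕ p)) ≡⟨ cong (λ i → (p C i) * x ^ (p ∸ i)) (toℕ-fromℕ p) ⟩
      (p C p) * x ^ (p ∸ p)                         ≡⟨ cong₂ (λ u v → u * x ^ v) (nCn≡1 p) (n∸n≡0 p) ⟩
      1 * 1                                         ∎

  fermat-little : ∀ {p} → Prime p → ∀ x → ∃[ k ] x ^ p ≡ x + k * p
  fermat-little {suc n} pp zero = 0 , refl
  fermat-little {p} pp (suc x) with fermat-little pp x | [1+x]^p≡x^p+1-mod-p pp x
  ... | k , x^p≡x+kp | r , [1+x]^p≡x^p+rp+1 = k + r , (begin
    (1 + x) ^ p           ≡⟨ [1+x]^p≡x^p+rp+1 ⟩
    x ^ p + r * p + 1     ≡⟨ cong (λ u → u + r * p + 1) x^p≡x+kp ⟩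
    x + k * p + r * p + 1 ≡⟨ solve (x ∷ k ∷ r ∷ p ∷ []) ⟩
    1 + x + (k + r) * p   ∎)

  fermat-little-unit : ∀ {n} → Prime (suc n) → ∀ {x} → ¬ suc n ∣ x → ∃[ k ] x ^ n ≡ 1 + k * suc n
  fermat-little-unit {n} pp {zero} p∤x = contradiction (suc n ∣0) p∤x
  fermat-little-unit {n} pp {x@(suc _)} p∤x with fermat-little pp x
  ... | j , x^p≡x+jp with euclidsLemma x (x ^ n ∸ 1) pp p∣x[x^n∸1]
    where
    p∣x[x^n∸1] : suc n ∣ x * (x ^ n ∸ 1)
    p∣x[x^n∸1] = divides j (begin
      x * (x ^ n ∸ 1)     ≡⟨ *-distribˡ-∸ x (x ^ n) 1 ⟩
      x * x ^ n ∸ x * 1   ≡⟨ cong₂ _∸_ x^p≡x+jp (*-identityʳ x) ⟩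
      x + j * suc n ∸ x   ≡⟨ m+n∸m≡n x _ ⟩
      j * suc n           ∎)
  ... | inj₁ p∣x = contradiction p∣x p∤x
  ... | inj₂ (divides k x^n∸1≡kp) = k , (begin
    x ^ n               ≡⟨ m+[n∸m]≡n (m^n>0 x n) ⟨
    1 + (x ^ n ∸ 1)     ≡⟨ cong (1 +_) x^n∸1≡kp ⟩
    1 + k * suc n       ∎)

  m²+n²∣m^[2+4k]+n^[2+4k] : ∀ x y k → x * x + y * y ∣ x ^ (2 + k * 4) + y ^ (2 + k * 4)
  m²+n²∣m^[2+4k]+n^[2+4k] x y zero = divides 1 (square-sum x y)
    where
    square-sum : ∀ a b → a * (a * 1) + b * (b * 1) ≡ 1 * (a * a + b * b)
    square-sum = solve-∀
  m²+n²∣m^[2+4k]+n^[2+4k] x y (suc k) = ∣m+n∣m⇒∣n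
    (subst (x * x + y * y ∣_) (recurrence x y (x ^ (2 + k * 4)) (y ^ (2 + k * 4))) (m∣m*n _))
    (∣n⇒∣m*n (x * x * (y * y)) (m²+n²∣m^[2+4k]+n^[2+4k] x y k))
    where
    recurrence : ∀ u v a b → (u * u + v * v) * (u * u * a + v * v * b)
                           ≡ u * u * (v * v) * (a + b) + (u * (u * (u * (u * a))) + v * (v * (v * (v * b))))
    recurrence = solve-∀

  3+4q∤m²+n² : ∀ q → Prime (3 + q * 4) → ∀ {x y} →
               ¬ 3 + q * 4 ∣ x → ¬ 3 + q * 4 ∣ y → ¬ 3 + q * 4 ∣ x * x + y * y
  3+4q∤m²+n² q pp {x} {y} p∤x p∤y p∣x²+y²
    with fermat-little-unit pp p∤x | fermat-little-unit pp p∤y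
  ... | k , x^[2+4q]≡1+kp | l , y^[2+4q]≡1+lp = <⇒≱ (s≤s (s≤s (s≤s z≤n))) (∣⇒≤ p∣2)
    where
    regroup : ∀ k l q → 1 + k * (3 + q * 4) + (1 + l * (3 + q * 4)) ≡ (k + l) * (3 + q * 4) + 2
    regroup = solve-∀
    p∣2 : 3 + q * 4 ∣ 2
    p∣2 = ∣m+n∣m⇒∣n
      (subst (3 + q * 4 ∣_) (trans (cong₂ _+_ x^[2+4q]≡1+kp y^[2+4q]≡1+lp) (regroup k l q))
        (∣-trans p∣x²+y² (m²+n²∣m^[2+4k]+n^[2+4k] x y q)))
      (n∣m*n (k + l))

  3+4q∣m²+n²⇒∣m : ∀ q → Prime (3 + q * 4) → ∀ x y → 3 + q * 4 ∣ x * x + y * y → 3 + q * 4 ∣ x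
  3+4q∣m²+n²⇒∣m q pp x y p∣x²+y² with 3 + q * 4 ∣? x
  ... | yes p∣x = p∣x
  ... | no  p∤x = contradiction p∣x²+y² (3+4q∤m²+n² q pp p∤x p∤y)
    where
    p∤y : ¬ 3 + q * 4 ∣ y
    p∤y p∣y = p∤x (prime∣m*m⇒∣m pp x
      (∣m+n∣m⇒∣n (subst (3 + q * 4 ∣_) (+-comm (x * x) (y * y)) p∣x²+y²) (∣m⇒∣m*n y p∣y)))

  mod4-cases : ∀ n → n % 4 ≡ 1 ⊎ (∃[ q ] n ≡ 3 + q * 4) ⊎ 2 ∣ n
  mod4-cases 0 = inj₂ (inj₂ (2 ∣0))
  mod4-cases 1 = inj₁ refl
  mod4-cases 2 = inj₂ (inj₂ ∣-refl)
  mod4-cases 3 = inj₂ (inj₁ (0 , refl))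
  mod4-cases (suc (suc (suc (suc n)))) with mod4-cases n
  ... | inj₁ n%4≡1               = inj₁ n%4≡1
  ... | inj₂ (inj₁ (q , n≡3+4q)) = inj₂ (inj₁ (suc q , cong (4 +_) n≡3+4q))
  ... | inj₂ (inj₂ 2∣n)          = inj₂ (inj₂ (∣m∣n⇒∣m+n (divides 2 refl) 2∣n))

  even-prime≡2 : ∀ {p} → Prime p → 2 ∣ p → p ≡ 2
  even-prime≡2 pp 2∣p = [ (λ ()) , sym ]′ (prime⇒irreducible pp 2∣p)

module MagicSquare where
  open import Defs
  import Data.Integer as ℤ
  open ℤ using (ℤ; +_; ∣_∣; sign; _◃_)
  open import Data.Integer.Properties using (*-identityʳ; +◃n≡+n; +-injective)
  import Data.Sign as Sign
  open import Data.Sign.Properties using (s*s≡+)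
  open import Data.Nat using (ℕ; _+_; _*_)
  open import Data.Nat.Properties using (+-cancelˡ-≡; +-comm; <⇒≱)
  open import Data.Nat.Divisibility using (_∣_; ∣⇒≤; ∣m⇒∣m*n; ∣n⇒∣m*n)
  open import Data.Nat.GCD using (gcd-greatest)
  open import Data.Nat.Primality using (Prime)
  open import Data.Nat.Tactic.RingSolver using (solve-∀)
  open import Data.Product using (_×_; _,_)
  open import Relation.Nullary using (¬_)
  open import Relation.Binary.PropositionalEquality
  open SumsOfTwoSquares using (prime⇒p>1; prime∣m*m⇒∣m; 3+4q∣m²+n²⇒∣m)
  open ≡-Reasoning

  ∣_∣² : ℤ → ℕ
  ∣ z ∣² = ∣ z ∣ * ∣ z ∣

  i^2≡+∣i∣² : ∀ z → z ℤ.^ 2 ≡ + ∣ z ∣²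
  i^2≡+∣i∣² z = begin
    z ℤ.* (z ℤ.* ℤ.1ℤ)              ≡⟨ cong (z ℤ.*_) (*-identityʳ z) ⟩
    (sign z Sign.* sign z) ◃ ∣ z ∣² ≡⟨ cong (_◃ ∣ z ∣²) (s*s≡+ (sign z)) ⟩
    Sign.+ ◃ ∣ z ∣²                 ≡⟨ +◃n≡+n ∣ z ∣² ⟩
    + ∣ z ∣²                        ∎

  ^2-sum≡⇒∣∣²-sum≡ : ∀ x y z u v w →
    x ℤ.^ 2 ℤ.+ y ℤ.^ 2 ℤ.+ z ℤ.^ 2 ≡ u ℤ.^ 2 ℤ.+ v ℤ.^ 2 ℤ.+ w ℤ.^ 2 →
    ∣ x ∣² + ∣ y ∣² + ∣ z ∣² ≡ ∣ u ∣² + ∣ v ∣² + ∣ w ∣²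
  ^2-sum≡⇒∣∣²-sum≡ x y z u v w eq
    rewrite i^2≡+∣i∣² x | i^2≡+∣i∣² y | i^2≡+∣i∣² z | i^2≡+∣i∣² u | i^2≡+∣i∣² v | i^2≡+∣i∣² w
    = +-injective eq

  magic-sum≡3*center : ∀ A B C D E F G H I →
    D + E + F ≡ A + B + C → G + H + I ≡ A + B + C → B + E + H ≡ A + B + C →
    A + E + I ≡ A + B + C → C + E + G ≡ A + B + C → A + B + C ≡ 3 * E
  magic-sum≡3*center A B C D E F G H I r₂ r₃ c₂ d₁ d₂ = +-cancelˡ-≡ (S + S + S) S (3 * E) (begin
    S + S + S + S                                         ≡⟨ cong₂ _+_ (cong₂ _+_ (cong₂ _+_ r₂ c₂) d₁) d₂ ⟨
    (D + E + F) + (B + E + H) + (A + E + I) + (C + E + G) ≡⟨ regroup A B C D E F G H I ⟩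
    S + (D + E + F) + (G + H + I) + 3 * E                 ≡⟨ cong₂ (λ u v → S + u + v + 3 * E) r₂ r₃ ⟩
    S + S + S + 3 * E                                     ∎)
    where
    S = A + B + C
    regroup : ∀ A B C D E F G H I → (D + E + F) + (B + E + H) + (A + E + I) + (C + E + G)
                                  ≡ (A + B + C) + (D + E + F) + (G + H + I) + 3 * E
    regroup = solve-∀

  opposite-sum≡2*center : ∀ X E Y → X + E + Y ≡ 3 * E → X + Y ≡ 2 * E
  opposite-sum≡2*center X E Y eq = +-cancelˡ-≡ E (X + Y) (2 * E) (trans (regroup X E Y) eq)
    where
    regroup : ∀ X E Y → E + (X + Y) ≡ X + E + Y
    regroup = solve-∀

  CentrallyBalanced : (a b c d e f g h i : ℤ) → Set
  CentrallyBalanced a b c d e f g h i =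
    ∣ a ∣² + ∣ i ∣² ≡ 2 * ∣ e ∣² × ∣ c ∣² + ∣ g ∣² ≡ 2 * ∣ e ∣² ×
    ∣ b ∣² + ∣ h ∣² ≡ 2 * ∣ e ∣² × ∣ d ∣² + ∣ f ∣² ≡ 2 * ∣ e ∣²

  magic⇒centrallyBalanced : ∀ a b c d e f g h i →
    IsMagicSquareOfSquares a b c d e f g h i → CentrallyBalanced a b c d e f g h i
  magic⇒centrallyBalanced a b c d e f g h i (_ , r₂ , r₃ , _ , c₂ , _ , d₁ , d₂) =
    opposite-sum≡2*center ∣ a ∣² ∣ e ∣² ∣ i ∣² (trans (line a e i d₁) S≡3E) ,
    opposite-sum≡2*center ∣ c ∣² ∣ e ∣² ∣ g ∣² (trans (line c e g d₂) S≡3E) ,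
    opposite-sum≡2*center ∣ b ∣² ∣ e ∣² ∣ h ∣² (trans (line b e h c₂) S≡3E) ,
    opposite-sum≡2*center ∣ d ∣² ∣ e ∣² ∣ f ∣² (trans (line d e f r₂) S≡3E)
    where
    line : ∀ x y z → x ℤ.^ 2 ℤ.+ y ℤ.^ 2 ℤ.+ z ℤ.^ 2 ≡ a ℤ.^ 2 ℤ.+ b ℤ.^ 2 ℤ.+ c ℤ.^ 2 →
           ∣ x ∣² + ∣ y ∣² + ∣ z ∣² ≡ ∣ a ∣² + ∣ b ∣² + ∣ c ∣²
    line x y z = ^2-sum≡⇒∣∣²-sum≡ x y z a b c
    S≡3E : ∣ a ∣² + ∣ b ∣² + ∣ c ∣² ≡ 3 * ∣ e ∣²
    S≡3E = magic-sum≡3*center ∣ a ∣² ∣ b ∣² ∣ c ∣² ∣ d ∣² ∣ e ∣² ∣ f ∣² ∣ g ∣² ∣ h ∣² ∣ i ∣²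
      (line d e f r₂) (line g h i r₃) (line b e h c₂) (line a e i d₁) (line c e g d₂)

  3+4q∤center : ∀ q a b c d e f g h i →
    CentrallyBalanced a b c d e f g h i → IsPrimitive a b c d e f g h i →
    Prime (3 + q * 4) → ¬ 3 + q * 4 ∣ ∣ e ℤ.^ 2 ∣
  3+4q∤center q a b c d e f g h i (a+i , c+g , b+h , d+f) gcd≡1 pp p∣e² =
    <⇒≱ (prime⇒p>1 pp) (∣⇒≤ p∣1)
    where
    p = 3 + q * 4
    p∣2∣e∣² : p ∣ 2 * ∣ e ∣²
    p∣2∣e∣² = ∣n⇒∣m*n 2 (subst (p ∣_) (cong ∣_∣ (i^2≡+∣i∣² e)) p∣e²)
    p∣left² : ∀ x y → ∣ x ∣² + ∣ y ∣² ≡ 2 * ∣ e ∣² → p ∣ ∣ x ℤ.^ 2 ∣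
    p∣left² x y eq = subst (p ∣_) (cong ∣_∣ (sym (i^2≡+∣i∣² x)))
      (∣m⇒∣m*n ∣ x ∣ (3+4q∣m²+n²⇒∣m q pp ∣ x ∣ ∣ y ∣ (subst (p ∣_) (sym eq) p∣2∣e∣²)))
    p∣right² : ∀ x y → ∣ x ∣² + ∣ y ∣² ≡ 2 * ∣ e ∣² → p ∣ ∣ y ℤ.^ 2 ∣
    p∣right² x y eq = p∣left² y x (trans (+-comm ∣ y ∣² ∣ x ∣²) eq)
    p∣1 : p ∣ 1
    p∣1 = subst (p ∣_) (cong ∣_∣ gcd≡1)
      (gcd-greatest (p∣left² a i a+i) (gcd-greatest (p∣left² b h b+h) (gcd-greatest (p∣left² c g c+g)
      (gcd-greatest (p∣left² d f d+f) (gcd-greatest p∣e² (gcd-greatest (p∣right² d f d+f)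
      (gcd-greatest (p∣right² c g c+g) (gcd-greatest (p∣right² b h b+h) (p∣right² a i a+i)))))))))

open import Defs
open import Data.Integer using (ℤ; +_; _^_)
open import Data.Integer.Divisibility using (_∣_)
open import Data.Nat using (ℕ; _%_; _+_; _*_)
open import Data.Nat.Primality using (Prime)
open import Data.Sum using (_⊎_; inj₁; inj₂; [_,_]′)
open import Data.Product using (∃-syntax; _,_)
open import Data.Empty using (⊥-elim)
open import Function using (_∘_)
open import Relation.Nullary using (¬_)
open import Relation.Binary.PropositionalEquality using (_≡_; refl)
open SumsOfTwoSquares using (mod4-cases; even-prime≡2)
open MagicSquare using (magic⇒centrallyBalanced; 3+4q∤center)

theorem3p1 : (a b c d e f g h i : ℤ) →
    IsMagicSquareOfSquares a b c d e f g h i →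
    IsPrimitive a b c d e f g h i →
    (p : ℕ) → Prime p → (+ p) ∣ (e ^ 2) →
    (p ≡ 2) ⊎ (p % 4 ≡ 1)
theorem3p1 a b c d e f g h i magic gcd≡1 p pp p∣e² =
  [ inj₂ , [ ⊥-elim ∘ p≢3+4q , inj₁ ∘ even-prime≡2 pp ]′ ]′ (mod4-cases p)
  where
  p≢3+4q : ¬ (∃[ q ] p ≡ 3 + q * 4)
  p≢3+4q (q , refl) =
    3+4q∤center q a b c d e f g h i (magic⇒centrallyBalanced a b c d e f g h i magic) gcd≡1 pp p∣e²
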